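{- Let $\mathbb G$ be a reflexive digraph with vertex set $G$, and let $\nu$ be its radical equivalence. Then $\nu$ is the smallest equivalence relation $\mu$ on $G$ such that the quotient digraph $\mathbb G/\mu$ is antisymmetric.
   Context: For a digraph $\mathbb G$ and an equivalence $\alpha$ on its vertex set $G$, $\mathbb G/\alpha$ is the digraph with vertex set $G/\alpha$ and with an edge $A\to B$ iff there is an edge $a\to b$ of $\mathbb G$ with $a\in A$, $b\in B$. A symmetric $(a,b)$-path is a sequence $a=a_0,\dots,a_n=b$ with $a_i\to a_{i+1}$ and $a_{i+1}\to a_i$ for all $i<n$; the extreme equivalence of $\mathbb G$ consists of all pairs $(a,b)$ joined by a symmetric $(a,b)$-path. The radical equivalence of a reflexive digraph $\mathbb G$ is defined as follows: $\nu_0$ is the extreme equivalence of $\mathbb G$; given $\nu_i$, let $\nu_i'$ be the extreme equivalence of $\mathbb G/\nu_i$ and $\nu_{i+1}=\{(a,b): a/\nu_i\ \nu_i'\ b/\nu_i\}$. Then $\nu_0\subseteq\nu_1\subseteq\cdots$ and the radical equivalence is $\nu=\bigcup_{i\ge0}\nu_i$. A digraph is antisymmetric if $A\to B$ and $B\to A$ imply $A=B$. -}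

module Defs where

open import Level using (0ℓ)
open import Data.Nat using (ℕ; zero; suc)
open import Data.Product using (Σ; ∃; _×_; _,_)
open import Relation.Binary.Core using (Rel)
open import Relation.Binary.PropositionalEquality using (_≡_)

Reflexive : {G : Set} → Rel G 0ℓ → Set
Reflexive {G} E = (x : G) → E x x

-- Quotient digraph G/μ, with classes represented by their members:
-- x/μ → y/μ iff there is an edge a → b with a ∈ x/μ, b ∈ y/μ.
QEdge : {G : Set} → Rel G 0ℓ → Rel G 0ℓ → Rel G 0ℓ
QEdge {G} E μ x y = Σ G λ a → Σ G λ b → μ x a × μ y b × E a b

data SymPath {V : Set} (E : Rel V 0ℓ) : V → V → Set where
  here : ∀ {a} → SymPath E a a
  step : ∀ {a c b} → E a c → E c a → SymPath E c b → SymPath E a b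

Extreme : {V : Set} → Rel V 0ℓ → Rel V 0ℓ
Extreme E = SymPath E

-- Symmetric path in the quotient digraph G/μ from the class of a to the
-- class of b (classes represented by members; class equality is μ).
data SymPathQ {G : Set} (E μ : Rel G 0ℓ) : G → G → Set where
  here : ∀ {a b} → μ a b → SymPathQ E μ a b
  step : ∀ {a c b} → QEdge E μ a c → QEdge E μ c a → SymPathQ E μ c b → SymPathQ E μ a b

-- ν_i : ν_0 = extreme equivalence of G;
-- ν_{i+1} a b iff (a/ν_i , b/ν_i) lies in the extreme equivalence of G/ν_i.
nu : {G : Set} → Rel G 0ℓ → ℕ → Rel G 0ℓ
nu E zero    = Extreme E
nu E (suc i) = SymPathQ E (nu E i)

Radical : {G : Set} → Rel G 0ℓ → Rel G 0ℓ
Radical E a b = ∃ λ i → nu E i a b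

QuotientAntisymmetric : {G : Set} → Rel G 0ℓ → Rel G 0ℓ → Set
QuotientAntisymmetric {G} E μ = (x y : G) → QEdge E μ x y → QEdge E μ y x → μ x y

{-# OPTIONS --safe #-}
module Submission where

open import Defs
open import Level using (0ℓ)
open import Data.Nat using (zero; suc; _≤_; _⊔_; _≤′_; ≤′-refl; ≤′-step)
open import Data.Nat.Properties using (≤⇒≤′; m≤m⊔n; m≤n⊔m)
open import Data.Product using (_×_; _,_; ∃)
open import Relation.Binary.Core using (Rel; _⇒_)
open import Relation.Binary.Structures using (IsEquivalence)

-- Each ν_i is an equivalence and the ν_i increase, so ν is an equivalence, and
-- any two quotient edges of G/ν already live in a common G/ν_i; a symmetric pair
-- of them is then a one-step symmetric path of G/ν_i, i.e. lies in ν_{i+1} ⊆ ν.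
-- Conversely, if G/μ is antisymmetric and ν_i ⊆ μ, every symmetric pair of edges
-- of G/ν_i is one of G/μ, so its ends are μ-related; induction gives ν_{i+1} ⊆ μ.

module _ {G : Set} (E : Rel G 0ℓ) where

  SymPath-trans : ∀ {a b c} → SymPath E a b → SymPath E b c → SymPath E a c
  SymPath-trans here         q = q
  SymPath-trans (step e f p) q = step e f (SymPath-trans p q)

  SymPath-sym : ∀ {a b} → SymPath E a b → SymPath E b a
  SymPath-sym here         = here
  SymPath-sym (step e f p) = SymPath-trans (SymPath-sym p) (step f e here)

  SymPath-isEquivalence : IsEquivalence (SymPath E)
  SymPath-isEquivalence = record
    { refl = here ; sym = SymPath-sym ; trans = SymPath-trans }

  QEdge-mono : ∀ (ρ μ : Rel G 0ℓ) → ρ ⇒ μ → QEdge E ρ ⇒ QEdge E μ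
  QEdge-mono _ _ ρ⇒μ (a , b , xa , yb , e) = a , b , ρ⇒μ xa , ρ⇒μ yb , e

  module _ {μ : Rel G 0ℓ} (μ-isEquivalence : IsEquivalence μ) where
    open IsEquivalence μ-isEquivalence

    QEdge-respˡ : ∀ {x x′ y} → μ x x′ → QEdge E μ x′ y → QEdge E μ x y
    QEdge-respˡ xx′ (a , b , x′a , yb , e) = a , b , trans xx′ x′a , yb , e

    QEdge-respʳ : ∀ {x y y′} → μ y y′ → QEdge E μ x y′ → QEdge E μ x y
    QEdge-respʳ yy′ (a , b , xa , y′b , e) = a , b , xa , trans yy′ y′b , e

    QEdge-of-edge : ∀ {a b} → E a b → QEdge E μ a b
    QEdge-of-edge {a} {b} e = a , b , refl , refl , e

    SymPathQ-trans : ∀ {a b c} → SymPathQ E μ a b → SymPathQ E μ b c → SymPathQ E μ a c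
    SymPathQ-trans (here ab)    (here bc)    = here (trans ab bc)
    SymPathQ-trans (here ab)    (step e f q) = step (QEdge-respˡ ab e) (QEdge-respʳ ab f) q
    SymPathQ-trans (step e f p) q            = step e f (SymPathQ-trans p q)

    SymPathQ-sym : ∀ {a b} → SymPathQ E μ a b → SymPathQ E μ b a
    SymPathQ-sym (here ab)    = here (sym ab)
    SymPathQ-sym (step e f p) = SymPathQ-trans (SymPathQ-sym p) (step f e (here refl))

    SymPathQ-isEquivalence : IsEquivalence (SymPathQ E μ)
    SymPathQ-isEquivalence = record
      { refl = here refl ; sym = SymPathQ-sym ; trans = SymPathQ-trans }

  nu-isEquivalence : ∀ i → IsEquivalence (nu E i)
  nu-isEquivalence zero    = SymPath-isEquivalence
  nu-isEquivalence (suc i) = SymPathQ-isEquivalence (nu-isEquivalence i)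

  nu-mono′ : ∀ {i j} → i ≤′ j → nu E i ⇒ nu E j
  nu-mono′ ≤′-refl      p = p
  nu-mono′ (≤′-step i≤j) p = here (nu-mono′ i≤j p)

  nu-mono : ∀ {i j} → i ≤ j → nu E i ⇒ nu E j
  nu-mono i≤j = nu-mono′ (≤⇒≤′ i≤j)

  nu⇒nu-⊔ˡ : ∀ i j → nu E i ⇒ nu E (i ⊔ j)
  nu⇒nu-⊔ˡ i j = nu-mono (m≤m⊔n i j)

  nu⇒nu-⊔ʳ : ∀ i j → nu E j ⇒ nu E (i ⊔ j)
  nu⇒nu-⊔ʳ i j = nu-mono (m≤n⊔m i j)

  Radical-isEquivalence : IsEquivalence (Radical E)
  Radical-isEquivalence = record
    { refl  = 0 , here
    ; sym   = λ { (i , p) → i , IsEquivalence.sym (nu-isEquivalence i) p }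
    ; trans = λ { (i , p) (j , q) →
        i ⊔ j , IsEquivalence.trans (nu-isEquivalence (i ⊔ j)) (nu⇒nu-⊔ˡ i j p) (nu⇒nu-⊔ʳ i j q) }
    }

  QEdge-Radical⇒QEdge-nu : ∀ {x y} → QEdge E (Radical E) x y → ∃ λ i → QEdge E (nu E i) x y
  QEdge-Radical⇒QEdge-nu (a , b , (i , xa) , (j , yb) , e) =
    i ⊔ j , a , b , nu⇒nu-⊔ˡ i j xa , nu⇒nu-⊔ʳ i j yb , e

  Radical-quotientAntisymmetric : QuotientAntisymmetric E (Radical E)
  Radical-quotientAntisymmetric x y xy yx
    with QEdge-Radical⇒QEdge-nu xy | QEdge-Radical⇒QEdge-nu yx
  ... | i , xyᵢ | j , yxⱼ =
    suc (i ⊔ j) , step (QEdge-mono (nu E i) _ (nu⇒nu-⊔ˡ i j) xyᵢ)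
                       (QEdge-mono (nu E j) _ (nu⇒nu-⊔ʳ i j) yxⱼ)
                       (here (IsEquivalence.refl (nu-isEquivalence (i ⊔ j))))

  module _ {μ : Rel G 0ℓ} (μ-isEquivalence : IsEquivalence μ)
           (μ-antisymmetric : QuotientAntisymmetric E μ) where
    open IsEquivalence μ-isEquivalence

    Extreme⇒μ : Extreme E ⇒ μ
    Extreme⇒μ here = refl
    Extreme⇒μ (step {a} {c} e f p) =
      trans (μ-antisymmetric a c (QEdge-of-edge μ-isEquivalence e) (QEdge-of-edge μ-isEquivalence f))
            (Extreme⇒μ p)

    SymPathQ⇒μ : ∀ {ρ : Rel G 0ℓ} → ρ ⇒ μ → SymPathQ E ρ ⇒ μ
    SymPathQ⇒μ ρ⇒μ (here ab) = ρ⇒μ ab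
    SymPathQ⇒μ {ρ} ρ⇒μ (step {a} {c} e f p) =
      trans (μ-antisymmetric a c (QEdge-mono ρ μ ρ⇒μ e) (QEdge-mono ρ μ ρ⇒μ f)) (SymPathQ⇒μ ρ⇒μ p)

    nu⇒μ : ∀ i → nu E i ⇒ μ
    nu⇒μ zero    = Extreme⇒μ
    nu⇒μ (suc i) = SymPathQ⇒μ (nu⇒μ i)

    Radical⇒μ : Radical E ⇒ μ
    Radical⇒μ (i , p) = nu⇒μ i p

proposition2p1 : (G : Set) (E : Rel G 0ℓ) → Reflexive E →
    IsEquivalence (Radical E)
    × QuotientAntisymmetric E (Radical E)
    × ((μ : Rel G 0ℓ) → IsEquivalence μ → QuotientAntisymmetric E μ →
         (a b : G) → Radical E a b → μ a b)
proposition2p1 G E _ =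
  Radical-isEquivalence E ,
  Radical-quotientAntisymmetric E ,
  λ μ μ-isEquivalence μ-antisymmetric a b → Radical⇒μ E μ-isEquivalence μ-antisymmetric
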